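{- Every equivalence class of $\mathcal{G}_4$ modulo the eight relations defining $\mathcal{GR}_4$ contains exactly one canonical tree.
   Context: $\mathcal{G}_4$ is the free (non-symmetric) set-operad on four binary generators $\prec,\succ,\circ,\odot$; its elements of arity $n$ are planar binary trees with $n$ leaves whose internal nodes are labelled by $\prec,\succ,\circ,\odot$. $\mathcal{GR}_4$ is the quotient of $\mathcal{G}_4$ by the operad congruence generated by the relations (written with $x,y,z$ the three inputs) $(x\succ y)\prec z=x\succ(y\prec z)$, $(x\circ y)\circ z=x\circ(y\circ z)$, $(x\succ y)\circ z=x\succ(y\circ z)$, $(x\prec y)\circ z=x\circ(y\succ z)$, $(x\circ y)\prec z=x\circ(y\prec z)$, $(x\odot y)\odot z=x\odot(y\odot z)$, $(x\prec y)\prec z=x\prec(y\odot z)$, $(x\odot y)\succ z=x\succ(y\succ z)$. A tree in $\mathcal{G}_4$ is canonical if there is no internal node labelled $a$ whose right child is an internal node labelled $b$ with $(a,b)\in\{(\succ,\prec),(\circ,\circ),(\succ,\circ),(\circ,\succ),(\circ,\prec),(\odot,\odot),(\prec,\odot),(\succ,\succ)\}$ (the patterns on the right-hand sides of the relations). -}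

module Defs where

open import Relation.Nullary using (¬_)

data Op : Set where
  prec succ circ odot : Op

-- Elements of the free non-symmetric set-operad G4: planar binary trees
-- with internal nodes labelled by Op (arity = number of leaves).
data Tree : Set where
  leaf : Tree
  node : Op → Tree → Tree → Tree

-- The eight defining relations, oriented left-hand side ⟶ right-hand side,
-- instantiated with arbitrary trees x y z (substitution into the inputs).
data Rel : Tree → Tree → Set where
  r1 : ∀ x y z → Rel (node prec (node succ x y) z) (node succ x (node prec y z))
  r2 : ∀ x y z → Rel (node circ (node circ x y) z) (node circ x (node circ y z))
  r3 : ∀ x y z → Rel (node circ (node succ x y) z) (node succ x (node circ y z))
  r4 : ∀ x y z → Rel (node circ (node prec x y) z) (node circ x (node succ y z))
  r5 : ∀ x y z → Rel (node prec (node circ x y) z) (node circ x (node prec y z))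
  r6 : ∀ x y z → Rel (node odot (node odot x y) z) (node odot x (node odot y z))
  r7 : ∀ x y z → Rel (node prec (node prec x y) z) (node prec x (node odot y z))
  r8 : ∀ x y z → Rel (node succ (node odot x y) z) (node succ x (node succ y z))

-- The operad congruence generated by the relations: the smallest
-- equivalence relation containing Rel and compatible with grafting
-- (i.e. closed under putting a rewrite inside any context).
infix 4 _≈_
data _≈_ : Tree → Tree → Set where
  ≈-rel   : ∀ {s t} → Rel s t → s ≈ t
  ≈-refl  : ∀ {t} → t ≈ t
  ≈-sym   : ∀ {s t} → s ≈ t → t ≈ s
  ≈-trans : ∀ {s t u} → s ≈ t → t ≈ u → s ≈ u
  ≈-node  : ∀ {a l l′ r r′} → l ≈ l′ → r ≈ r′ → node a l r ≈ node a l′ r′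

-- Forbidden (parent label, right-child label) patterns: the right-hand sides.
data Forbidden : Op → Op → Set where
  f1 : Forbidden succ prec
  f2 : Forbidden circ circ
  f3 : Forbidden succ circ
  f4 : Forbidden circ succ
  f5 : Forbidden circ prec
  f6 : Forbidden odot odot
  f7 : Forbidden prec odot
  f8 : Forbidden succ succ

data Canonical : Tree → Set where
  can-leaf : Canonical leaf
  can-nodeLeaf : ∀ {a l} → Canonical l → Canonical (node a l leaf)
  can-nodeNode : ∀ {a b l rl rr} → ¬ Forbidden a b → Canonical l →
                 Canonical (node b rl rr) → Canonical (node a l (node b rl rr))

-- Orient every relation from its right-hand side to its left-hand side,
-- x a (y b z) ⟶ (x a′ y) b′ z.  Canonical trees are exactly the normal forms,
-- and grafting a node onto two canonical trees can be normalised by recursion on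
-- the right subtree.  The sixteen overlaps x a (y b (z c w)) of two forbidden
-- patterns are each joinable in two steps on either side, so normalised
-- grafting satisfies the eight relations.  Evaluating a tree with it therefore
-- gives a canonical representative that is invariant under ≈ and fixes every
-- canonical tree.
module Submission where

open import Defs
open import Data.Empty using (⊥-elim)
open import Data.Product using (Σ; _×_; _,_)
open import Relation.Binary.PropositionalEquality
  using (_≡_; refl; sym; trans; cong; cong₂; module ≡-Reasoning)
open import Relation.Nullary using (¬_; Dec; yes; no)

private
  variable
    a b c : Op
    x y z : Tree

forbidden? : (a b : Op) → Dec (Forbidden a b)
forbidden? prec prec = no λ ()
forbidden? prec succ = no λ ()
forbidden? prec circ = no λ ()
forbidden? prec odot = yes f7
forbidden? succ prec = yes f1
forbidden? succ succ = yes f8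
forbidden? succ circ = yes f3
forbidden? succ odot = no λ ()
forbidden? circ prec = yes f5
forbidden? circ succ = yes f4
forbidden? circ circ = yes f2
forbidden? circ odot = no λ ()
forbidden? odot prec = no λ ()
forbidden? odot succ = no λ ()
forbidden? odot circ = no λ ()
forbidden? odot odot = yes f6

-- The relation with right-hand side x a (y b z) has left-hand side (x inner y) outer z.
inner outer : Forbidden a b → Op
inner f1 = succ
inner f2 = circ
inner f3 = succ
inner f4 = prec
inner f5 = circ
inner f6 = odot
inner f7 = prec
inner f8 = odot
outer f1 = prec
outer f2 = circ
outer f3 = circ
outer f4 = circ
outer f5 = prec
outer f6 = odot
outer f7 = prec
outer f8 = succ

forbidden-rel : (F : Forbidden a b) →
                Rel (node (outer F) (node (inner F) x y) z) (node a x (node b y z))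
forbidden-rel f1 = r1 _ _ _
forbidden-rel f2 = r2 _ _ _
forbidden-rel f3 = r3 _ _ _
forbidden-rel f4 = r4 _ _ _
forbidden-rel f5 = r5 _ _ _
forbidden-rel f6 = r6 _ _ _
forbidden-rel f7 = r7 _ _ _
forbidden-rel f8 = r8 _ _ _

-- The overlap x a (y b (z c w)) rewrites at y b (z c w) and then twice more to
--   ((x (inner K) y) (outer K) z) (outer H) w,
-- and at the root and then once more to
--   ((x (inner F) y) (inner L) z) (outer L) w.
record Joinable (F : Forbidden a b) (G : Forbidden b c) : Set where
  constructor joinable
  field
    H : Forbidden a (outer G)
    K : Forbidden (inner H) (inner G)
    L : Forbidden (outer F) c
    outerH≡outerL : outer H ≡ outer L
    outerK≡innerL : outer K ≡ inner L
    innerK≡innerF : inner K ≡ inner F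

criticalPair : (F : Forbidden a b) (G : Forbidden b c) → Joinable F G
criticalPair f1 f7 = joinable f1 f1 f7 refl refl refl
criticalPair f2 f2 = joinable f2 f2 f2 refl refl refl
criticalPair f2 f4 = joinable f2 f5 f4 refl refl refl
criticalPair f2 f5 = joinable f5 f2 f5 refl refl refl
criticalPair f3 f2 = joinable f3 f3 f2 refl refl refl
criticalPair f3 f4 = joinable f3 f1 f4 refl refl refl
criticalPair f3 f5 = joinable f1 f3 f5 refl refl refl
criticalPair f4 f1 = joinable f5 f4 f5 refl refl refl
criticalPair f4 f3 = joinable f2 f4 f2 refl refl refl
criticalPair f4 f8 = joinable f4 f7 f4 refl refl refl
criticalPair f5 f7 = joinable f5 f5 f7 refl refl refl
criticalPair f6 f6 = joinable f6 f6 f6 refl refl refl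
criticalPair f7 f6 = joinable f7 f7 f7 refl refl refl
criticalPair f8 f1 = joinable f1 f8 f1 refl refl refl
criticalPair f8 f3 = joinable f3 f8 f3 refl refl refl
criticalPair f8 f8 = joinable f8 f6 f8 refl refl refl

normNode : Op → Tree → Tree → Tree
normNode a x leaf = node a x leaf
normNode a x (node c y z) with forbidden? a c
... | yes F = normNode (outer F) (normNode (inner F) x y) z
... | no _  = node a x (node c y z)

normNode-forbidden : (F : Forbidden a c) →
                     normNode a x (node c y z) ≡ normNode (outer F) (normNode (inner F) x y) z
normNode-forbidden f1 = refl
normNode-forbidden f2 = refl
normNode-forbidden f3 = refl
normNode-forbidden f4 = refl
normNode-forbidden f5 = refl
normNode-forbidden f6 = refl
normNode-forbidden f7 = refl
normNode-forbidden f8 = refl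

normNode-allowed : ¬ Forbidden a c → normNode a x (node c y z) ≡ node a x (node c y z)
normNode-allowed {a} {c} ¬F with forbidden? a c
... | yes F = ⊥-elim (¬F F)
... | no _  = refl

normNode-≈ : ∀ a x y → normNode a x y ≈ node a x y
normNode-≈ a x leaf = ≈-refl
normNode-≈ a x (node c y z) with forbidden? a c
... | yes F = ≈-trans (normNode-≈ (outer F) _ z)
                (≈-trans (≈-node (normNode-≈ (inner F) x y) ≈-refl) (≈-rel (forbidden-rel F)))
... | no _  = ≈-refl

canonical-left : Canonical (node a x y) → Canonical x
canonical-left (can-nodeLeaf cx)     = cx
canonical-left (can-nodeNode _ cx _) = cx

canonical-right : Canonical (node a x y) → Canonical y
canonical-right (can-nodeLeaf _)      = can-leaf
canonical-right (can-nodeNode _ _ cy) = cy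

normNode-canonical : ∀ a {x} y → Canonical x → Canonical y → Canonical (normNode a x y)
normNode-canonical a leaf cx _ = can-nodeLeaf cx
normNode-canonical a (node c y z) cx cyz with forbidden? a c
... | yes F = normNode-canonical (outer F) z
                (normNode-canonical (inner F) y cx (canonical-left cyz)) (canonical-right cyz)
... | no ¬F = can-nodeNode ¬F cx cyz

normNode-rule : (F : Forbidden a b) → ∀ x y z →
                normNode a x (normNode b y z) ≡ normNode (outer F) (normNode (inner F) x y) z
normNode-rule F x y leaf = normNode-forbidden F
normNode-rule {a} {b} F x y (node c z w) with forbidden? b c
... | no _  = normNode-forbidden F
... | yes G = begin
  normNode a x (normNode (outer G) (normNode (inner G) y z) w)
    ≡⟨ normNode-rule H x (normNode (inner G) y z) w ⟩
  normNode (outer H) (normNode (inner H) x (normNode (inner G) y z)) w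
    ≡⟨ cong (λ t → normNode (outer H) t w) (normNode-rule K x y z) ⟩
  normNode (outer H) (normNode (outer K) (normNode (inner K) x y) z) w
    ≡⟨ cong₂ (λ o t → normNode o t w) outerH≡outerL
         (cong₂ (λ o i → normNode o (normNode i x y) z) outerK≡innerL innerK≡innerF) ⟩
  normNode (outer L) (normNode (inner L) (normNode (inner F) x y) z) w
    ≡⟨ sym (normNode-forbidden L) ⟩
  normNode (outer F) (normNode (inner F) x y) (node c z w)
    ∎
  where
    open ≡-Reasoning
    open Joinable (criticalPair F G)

normalise : Tree → Tree
normalise leaf         = leaf
normalise (node a x y) = normNode a (normalise x) (normalise y)

normalise-canonical : ∀ t → Canonical (normalise t)
normalise-canonical leaf         = can-leaf
normalise-canonical (node a x y) =
  normNode-canonical a (normalise y) (normalise-canonical x) (normalise-canonical y)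

normalise-≈ : ∀ t → normalise t ≈ t
normalise-≈ leaf         = ≈-refl
normalise-≈ (node a x y) = ≈-trans (normNode-≈ a _ _) (≈-node (normalise-≈ x) (normalise-≈ y))

normalise-fixes-canonical : ∀ {t} → Canonical t → normalise t ≡ t
normalise-fixes-canonical can-leaf = refl
normalise-fixes-canonical (can-nodeLeaf {a} cx) =
  cong (λ t → node a t leaf) (normalise-fixes-canonical cx)
normalise-fixes-canonical (can-nodeNode {a} ¬F cx cy) =
  trans (cong₂ (normNode a) (normalise-fixes-canonical cx) (normalise-fixes-canonical cy))
        (normNode-allowed ¬F)

normalise-respects-Rel : ∀ {s t} → Rel s t → normalise s ≡ normalise t
normalise-respects-Rel (r1 x y z) = sym (normNode-rule f1 (normalise x) (normalise y) (normalise z))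
normalise-respects-Rel (r2 x y z) = sym (normNode-rule f2 (normalise x) (normalise y) (normalise z))
normalise-respects-Rel (r3 x y z) = sym (normNode-rule f3 (normalise x) (normalise y) (normalise z))
normalise-respects-Rel (r4 x y z) = sym (normNode-rule f4 (normalise x) (normalise y) (normalise z))
normalise-respects-Rel (r5 x y z) = sym (normNode-rule f5 (normalise x) (normalise y) (normalise z))
normalise-respects-Rel (r6 x y z) = sym (normNode-rule f6 (normalise x) (normalise y) (normalise z))
normalise-respects-Rel (r7 x y z) = sym (normNode-rule f7 (normalise x) (normalise y) (normalise z))
normalise-respects-Rel (r8 x y z) = sym (normNode-rule f8 (normalise x) (normalise y) (normalise z))

normalise-respects-≈ : ∀ {s t} → s ≈ t → normalise s ≡ normalise t
normalise-respects-≈ (≈-rel r)       = normalise-respects-Rel r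
normalise-respects-≈ ≈-refl          = refl
normalise-respects-≈ (≈-sym p)       = sym (normalise-respects-≈ p)
normalise-respects-≈ (≈-trans p q)   = trans (normalise-respects-≈ p) (normalise-respects-≈ q)
normalise-respects-≈ (≈-node {a} p q) = cong₂ (normNode a) (normalise-respects-≈ p) (normalise-respects-≈ q)

mainTheorem4 : (t : Tree) → Σ Tree (λ c → Canonical c × c ≈ t × ((c′ : Tree) → Canonical c′ → c′ ≈ t → c′ ≡ c))
mainTheorem4 t = normalise t , normalise-canonical t , normalise-≈ t , unique
  where
    unique : (c′ : Tree) → Canonical c′ → c′ ≈ t → c′ ≡ normalise t
    unique c′ cc′ c′≈t = trans (sym (normalise-fixes-canonical cc′)) (normalise-respects-≈ c′≈t)
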